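{- Let $A$ be a finite alphabet, $n\ge1$, and let $P(x_1,\dots,x_n)$ be an $n$-variable weakly regular predicate over $A$, with language $L\subseteq(A^\ast)^n$. Then there exist a finite alphabet $B\supseteq A$ and an $(n+1)$-variable quasi-regular predicate $Q(x_0,x_1,\dots,x_n)$ over $B$ such that for all $x_1,\dots,x_n\in B^\ast$: $(x_1,\dots,x_n)\in L$ if and only if there exists $x_0\in B^\ast$ with $Q(x_0,x_1,\dots,x_n)$.
   Context: Let $\$$ be a symbol not in the alphabet. Predicates are identified with the sets of tuples of words where they hold. An $m$-tape semi-sorted asynchronous automaton over an alphabet $C$ is a partial deterministic finite state automaton (unique start state, no $\epsilon$-transitions, at most one transition per state and letter) over $C\sqcup\{\$\}$ with a partition of its states into $m$ sets indexed by the tapes; it accepts $(w_1,\dots,w_m)$ iff there is a path from the start state to an accept state such that for each tape $i$ the concatenation of labels of transitions whose source lies in the $i$th set equals $w_i\$$. A predicate is quasi-regular if its language is accepted by such an automaton. A non-deterministic semi-sorted asynchronous automaton (SAA) is defined the same way starting from a non-deterministic finite state automaton (several start states, several transitions per letter, $\epsilon$-transitions allowed and contributing nothing to the concatenations); a predicate is weakly regular if accepted by an SAA. -}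

module Defs where

open import Data.Nat using (ℕ; _+_; _≤_)
open import Data.Fin using (Fin; _↑ˡ_) renaming (_≟_ to _≟F_)
open import Data.Bool using (Bool; true; if_then_else_)
open import Data.Maybe using (Maybe; just; nothing)
open import Data.List using (List; []; _∷_; _++_; [_]; catMaybes)
import Data.List as List
open import Data.Vec using (Vec; lookup; _∷_)
import Data.Vec as Vec
open import Data.Product using (Σ; ∃; _×_; _,_)
open import Relation.Nullary using (does)
open import Relation.Binary.PropositionalEquality using (_≡_)

-- Letters over C ⊔ {$}: `just c` is the letter c, `nothing` is the end marker $.
Letter : Set → Set
Letter C = Maybe C

-- A path as a list of steps (source state, label); Run T q steps q' says the
-- steps form a path from q to q' where each step (p , a) goes along a
-- transition p --a--> p'' with T p a p''.
data Run {S L : Set} (T : S → L → S → Set) : S → List (S × L) → S → Set where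
  done : ∀ {q} → Run T q [] q
  step : ∀ {q a q' rest r} → T q a q' → Run T q' rest r → Run T q ((q , a) ∷ rest) r

tapeLabels : {S L : Set} {m : ℕ} → (S → Fin m) → Fin m → List (S × L) → List L
tapeLabels tape i [] = []
tapeLabels tape i ((q , a) ∷ r) =
  if does (tape q ≟F i) then a ∷ tapeLabels tape i r else tapeLabels tape i r

withEnd : {C : Set} → List C → List (Letter C)
withEnd w = List.map just w ++ [ nothing ]

record DAut (C : Set) (m : ℕ) : Set where
  field
    nStates : ℕ
    start   : Fin nStates
    δ       : Fin nStates → Letter C → Maybe (Fin nStates)
    accept  : Fin nStates → Bool
    tape    : Fin nStates → Fin m

DAccepts : {C : Set} {m : ℕ} → DAut C m → Vec (List C) m → Set
DAccepts {C} {m} D ws =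
  Σ (Fin nStates) λ qf → Σ (List (Fin nStates × Letter C)) λ steps →
    Run (λ q a q' → δ q a ≡ just q') start steps qf × accept qf ≡ true ×
    ((i : Fin m) → tapeLabels tape i steps ≡ withEnd (lookup ws i))
  where open DAut D

-- m-tape non-deterministic semi-sorted asynchronous automaton (SAA);
-- transition labels `nothing` are ε-transitions.
record NAut (C : Set) (m : ℕ) : Set where
  field
    nStates : ℕ
    start   : Fin nStates → Bool
    δ       : Fin nStates → Maybe (Letter C) → Fin nStates → Bool
    accept  : Fin nStates → Bool
    tape    : Fin nStates → Fin m

NAccepts : {C : Set} {m : ℕ} → NAut C m → Vec (List C) m → Set
NAccepts {C} {m} N ws =
  Σ (Fin nStates) λ q0 → Σ (Fin nStates) λ qf →
  Σ (List (Fin nStates × Maybe (Letter C))) λ steps →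
    start q0 ≡ true × Run (λ q a q' → δ q a q' ≡ true) q0 steps qf × accept qf ≡ true ×
    ((i : Fin m) → catMaybes (tapeLabels tape i steps) ≡ withEnd (lookup ws i))
  where open NAut N

-- The alphabet A = Fin k is included in B = Fin (k + extra) via _↑ˡ_ (first k elements).
-- A tuple of words over B lies in the language of N (a language over A).
InLangOver : {k n : ℕ} (extra : ℕ) → NAut (Fin k) n → Vec (List (Fin (k + extra))) n → Set
InLangOver {k} {n} extra N xs =
  Σ (Vec (List (Fin k)) n) λ ys →
    Vec.map (List.map (_↑ˡ extra)) ys ≡ xs × NAccepts N ys

module Submission where

-- Given a non-deterministic SAA N with states 0..nQ-1 over A = Fin k, we build a
-- deterministic (n+1)-tape automaton D over B = A ⊔ {ε-to q} ⊔ {move-to q}.  The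
-- extra tape 0 carries a "certificate": the sequence of non-deterministic choices
-- of an accepting run of N.  Being at N-state q, D reads the next letter of tape 0:
--   * ε-to q'   follows the ε-transition q → q' of N,
--   * move-to q' announces a letter-transition q → q' and switches to the tape of q,
--                where the letter (or $) is read and checked against N,
--   * $          ends the certificate, allowed when q is accepting.
-- All non-determinism of N is thus resolved by x₀, so D is deterministic, and
-- (x₁,…,xₙ) ∈ L(N) iff some x₀ makes D accept (x₀,x₁,…,xₙ).

open import Defs
open import Data.Nat using (ℕ; suc; _+_; _*_; _≤_)
open import Data.Fin using (Fin; zero; suc; _↑ˡ_; _↑ʳ_; splitAt; combine; remQuot)
  renaming (_≟_ to _≟F_)
open import Data.Fin.Properties using (splitAt-↑ˡ; splitAt-↑ʳ; splitAt⁻¹-↑ˡ; remQuot-combine)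
open import Data.Bool using (Bool; true; false)
open import Data.Maybe using (Maybe; just; nothing; when)
import Data.Maybe as Maybe
open import Data.List using (List; []; _∷_; catMaybes)
import Data.List as List
open import Data.List.Properties using (∷-injective)
open import Data.Vec using (Vec; _∷_; lookup; tabulate)
import Data.Vec as Vec
open import Data.Vec.Properties using (lookup-map; tabulate∘lookup; tabulate-∘; tabulate-cong; lookup∘tabulate)
open import Data.Product using (Σ; _×_; _,_; proj₁; proj₂; map₁; uncurry)
open import Data.Sum using (inj₁; inj₂; [_,_]′)
open import Function using (_∘_)
open import Function.Bundles using (_⇔_; mk⇔)
open import Relation.Nullary using (yes; no)
open import Relation.Binary.PropositionalEquality using (_≡_; refl; sym; trans; cong; module ≡-Reasoning)

open ≡-Reasoning

tapeLabels-map : {S S' L : Set} {m : ℕ} (t : S → Fin m) (t' : S' → Fin m) (f : S → S') →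
  (∀ s → t' (f s) ≡ t s) → (i : Fin m) (ss : List (S × L)) →
  tapeLabels t' i (List.map (map₁ f) ss) ≡ tapeLabels t i ss
tapeLabels-map t t' f preserves i [] = refl
tapeLabels-map t t' f preserves i ((s , a) ∷ ss) rewrite preserves s with t s ≟F i
... | yes _ = cong (a ∷_) (tapeLabels-map t t' f preserves i ss)
... | no _  = tapeLabels-map t t' f preserves i ss

tapeLabels-ε : {S L : Set} {m : ℕ} (t : S → Fin m) (i : Fin m) (s : S) (ss : List (S × Maybe L)) →
  catMaybes (tapeLabels t i ((s , nothing) ∷ ss)) ≡ catMaybes (tapeLabels t i ss)
tapeLabels-ε t i s ss with t s ≟F i
... | yes _ = refl
... | no _  = refl

withEnd-map : {X Y : Set} (f : X → Y) (w : List X) →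
  List.map (Maybe.map f) (withEnd w) ≡ withEnd (List.map f w)
withEnd-map f []      = refl
withEnd-map f (x ∷ w) = cong (just (f x) ∷_) (withEnd-map f w)

withEnd-map⁻¹ : {X Y : Set} (f : X → Y) (L : List (Maybe X)) (w : List Y) →
  List.map (Maybe.map f) L ≡ withEnd w →
  Σ (List X) λ v → List.map f v ≡ w × L ≡ withEnd v
withEnd-map⁻¹ f []                  []      ()
withEnd-map⁻¹ f []                  (_ ∷ _) ()
withEnd-map⁻¹ f (nothing ∷ [])      []      refl = [] , refl , refl
withEnd-map⁻¹ f (nothing ∷ _ ∷ _)   []      ()
withEnd-map⁻¹ f (nothing ∷ _)       (_ ∷ _) ()
withEnd-map⁻¹ f (just _ ∷ _)        []      ()
withEnd-map⁻¹ f (just a ∷ L)        (y ∷ w) e with ∷-injective e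
... | refl , e' with withEnd-map⁻¹ f L w e'
...   | v , fv≡w , L≡v = a ∷ v , cong (f a ∷_) fv≡w , cong (just a ∷_) L≡v

lookup-mapped : {X Y : Set} {n : ℕ} (f : X → Y) {ys : Vec (List X) n} {xs : Vec (List Y) n} →
  Vec.map (List.map f) ys ≡ xs → (i : Fin n) → List.map f (lookup ys i) ≡ lookup xs i
lookup-mapped f {ys} refl i = sym (lookup-map i (List.map f) ys)

tabulate-mapped : {X Y : Set} {n : ℕ} (f : X → Y) (w : Fin n → List X) {xs : Vec (List Y) n} →
  (∀ i → List.map f (w i) ≡ lookup xs i) → Vec.map (List.map f) (tabulate w) ≡ xs
tabulate-mapped f w {xs} pointwise = begin
  Vec.map (List.map f) (tabulate w)  ≡⟨ sym (tabulate-∘ (List.map f) w) ⟩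
  tabulate (List.map f ∘ w)          ≡⟨ tabulate-cong pointwise ⟩
  tabulate (lookup xs)               ≡⟨ tabulate∘lookup xs ⟩
  xs                                 ∎

when-just : {X : Set} (b : Bool) {x y : X} → when b x ≡ just y → b ≡ true × x ≡ y
when-just true refl = refl , refl
when-just false ()

module Encoded {St L : Set} {M : ℕ} (code : St → Fin M) (decode : Fin M → St)
               (decode-code : ∀ s → decode (code s) ≡ s) (δS : St → L → Maybe St) where

  δE : Fin M → L → Maybe (Fin M)
  δE p a = Maybe.map code (δS (decode p) a)

  encode-run : ∀ {s ss s'} → Run (λ s a s' → δS s a ≡ just s') s ss s' →
    Run (λ p a p' → δE p a ≡ just p') (code s) (List.map (map₁ code) ss) (code s')
  encode-run done = done
  encode-run (step {q} {a} e r) =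
    step (trans (cong (λ t → Maybe.map code (δS t a)) (decode-code q)) (cong (Maybe.map code) e))
         (encode-run r)

  decode-run : ∀ {p ds p'} → Run (λ p a p' → δE p a ≡ just p') p ds p' →
    Run (λ s a s' → δS s a ≡ just s') (decode p) (List.map (map₁ decode) ds) (decode p')
  decode-run done = done
  decode-run (step {q} {a} e r) with δS (decode q) a in δS≡ | e
  ... | just s | refl = step (trans δS≡ (cong just (sym (decode-code s)))) (decode-run r)

module Simulation (k n : ℕ) (N : NAut (Fin k) n) where
  open NAut N renaming (nStates to nQ; start to isInitial; δ to δN; accept to isFinal; tape to tapeN)

  extra : ℕ
  extra = nQ + nQ

  B : Set
  B = Fin (k + extra)

  symbol : Fin k → B
  symbol a = a ↑ˡ extra

  εTo moveTo : Fin nQ → B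
  εTo q    = k ↑ʳ (q ↑ˡ nQ)
  moveTo q = k ↑ʳ (nQ ↑ʳ q)

  data Kind : Set where
    input       : Fin k → Kind
    choose-ε    : Fin nQ → Kind
    choose-move : Fin nQ → Kind

  classify : B → Kind
  classify x with splitAt k x
  ... | inj₁ a = input a
  ... | inj₂ y with splitAt nQ y
  ...   | inj₁ q = choose-ε q
  ...   | inj₂ q = choose-move q

  classify-symbol : ∀ a → classify (symbol a) ≡ input a
  classify-symbol a rewrite splitAt-↑ˡ k a extra = refl

  classify-εTo : ∀ q → classify (εTo q) ≡ choose-ε q
  classify-εTo q rewrite splitAt-↑ʳ k extra (q ↑ˡ nQ) | splitAt-↑ˡ nQ q nQ = refl

  classify-moveTo : ∀ q → classify (moveTo q) ≡ choose-move q
  classify-moveTo q rewrite splitAt-↑ʳ k extra (nQ ↑ʳ q) | splitAt-↑ʳ nQ nQ q = refl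

  classify-input⁻¹ : ∀ x {a} → classify x ≡ input a → symbol a ≡ x
  classify-input⁻¹ x e with splitAt k x in split | e
  ... | inj₁ a | refl = splitAt⁻¹-↑ˡ split
  ... | inj₂ y | e' with splitAt nQ y | e'
  ...   | inj₁ _ | ()
  ...   | inj₂ _ | ()

  -- States of D: `at q` simulates N in state q and reads tape 0; `reading q q'`
  -- reads the letter of the chosen transition q → q' from the tape of q.
  data State : Set where
    initial accepted : State
    at               : Fin nQ → State
    reading          : Fin nQ → Fin nQ → State

  afterStart : Kind → Maybe State
  afterStart (choose-ε q) = when (isInitial q) (at q)
  afterStart _            = nothing

  afterChoice : Fin nQ → Kind → Maybe State
  afterChoice q (input _)        = nothing
  afterChoice q (choose-ε q')    = when (δN q nothing q') (at q')
  afterChoice q (choose-move q') = just (reading q q')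

  afterInput : Fin nQ → Fin nQ → Kind → Maybe State
  afterInput q q' (input a) = when (δN q (just (just a)) q') (at q')
  afterInput q q' _         = nothing

  δS : State → Letter B → Maybe State
  δS initial        nothing  = nothing
  δS initial        (just x) = afterStart (classify x)
  δS accepted       _        = nothing
  δS (at q)         nothing  = when (isFinal q) accepted
  δS (at q)         (just x) = afterChoice q (classify x)
  δS (reading q q') nothing  = when (δN q (just nothing) q') (at q')
  δS (reading q q') (just x) = afterInput q q' (classify x)

  isAccepted : State → Bool
  isAccepted accepted = true
  isAccepted _        = false

  tapeS : State → Fin (suc n)
  tapeS (reading q _) = suc (tapeN q)
  tapeS _             = zero

  M : ℕ
  M = suc (suc (nQ + nQ * nQ))

  code : State → Fin M
  code initial        = zero
  code accepted       = suc zero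
  code (at q)         = suc (suc (q ↑ˡ (nQ * nQ)))
  code (reading q q') = suc (suc (nQ ↑ʳ combine q q'))

  decode : Fin M → State
  decode zero          = initial
  decode (suc zero)    = accepted
  decode (suc (suc x)) = [ at , uncurry reading ∘ remQuot {nQ} nQ ]′ (splitAt nQ x)

  decode-code : ∀ s → decode (code s) ≡ s
  decode-code initial  = refl
  decode-code accepted = refl
  decode-code (at q) rewrite splitAt-↑ˡ nQ q (nQ * nQ) = refl
  decode-code (reading q q') rewrite splitAt-↑ʳ nQ (nQ * nQ) (combine q q') =
    cong (uncurry reading) (remQuot-combine {nQ} {nQ} q q')

  open Encoded code decode decode-code δS using (δE; encode-run; decode-run)

  D : DAut B (suc n)
  D = record { nStates = M ; start = code initial ; δ = δE
             ; accept = isAccepted ∘ decode ; tape = tapeS ∘ decode }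

  StepN : Fin nQ → Maybe (Letter (Fin k)) → Fin nQ → Set
  StepN q a q' = δN q a q' ≡ true

  StepS : State → Letter B → State → Set
  StepS s a s' = δS s a ≡ just s'

  record SameInputs (ds : List (State × Letter B)) (ns : List (Fin nQ × Maybe (Letter (Fin k)))) : Set where
    constructor sameInputs
    field onTape : (i : Fin n) →
            tapeLabels tapeS (suc i) ds ≡ List.map (Maybe.map symbol) (catMaybes (tapeLabels tapeN i ns))

  sameInputs-initial : ∀ {c ds ns} → SameInputs ds ns → SameInputs ((initial , c) ∷ ds) ns
  sameInputs-initial (sameInputs same) = sameInputs same

  sameInputs-ε : ∀ {q c ds ns} → SameInputs ds ns → SameInputs ((at q , c) ∷ ds) ((q , nothing) ∷ ns)
  sameInputs-ε {q} {ns = ns} (sameInputs same) = sameInputs λ i →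
    trans (same i) (cong (List.map (Maybe.map symbol)) (sym (tapeLabels-ε tapeN i q ns)))

  sameInputs-read : ∀ {q q' c l ds ns} → SameInputs ds ns →
    SameInputs ((at q , c) ∷ (reading q q' , Maybe.map symbol l) ∷ ds) ((q , just l) ∷ ns)
  sameInputs-read {q} {q'} {l = l} {ds} {ns} (sameInputs same) = sameInputs onTape
    where
    onTape : (i : Fin n) → tapeLabels tapeS (suc i) ((reading q q' , Maybe.map symbol l) ∷ ds)
                           ≡ List.map (Maybe.map symbol) (catMaybes (tapeLabels tapeN i ((q , just l) ∷ ns)))
    onTape i with tapeN q ≟F i
    ... | yes _ = cong (Maybe.map symbol l ∷_) (same i)
    ... | no _  = same i

  reading-step : ∀ {q q'} l → StepN q (just l) q' → StepS (reading q q') (Maybe.map symbol l) (at q')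
  reading-step {q} {q'} nothing  t = cong (λ b → when b (at q')) t
  reading-step {q} {q'} (just a) t =
    trans (cong (afterInput q q') (classify-symbol a)) (cong (λ b → when b (at q')) t)

  reading-inv : ∀ {q q' s} c → StepS (reading q q') c s →
    Σ (Letter (Fin k)) λ l → StepN q (just l) q' × c ≡ Maybe.map symbol l × s ≡ at q'
  reading-inv {q} {q'} nothing e with when-just (δN q (just nothing) q') e
  ... | t , refl = nothing , t , refl , refl
  reading-inv {q} {q'} (just x) e with classify x in kind | e
  ... | input a | e' with when-just (δN q (just (just a)) q') e'
  ...   | t , refl = just a , t , cong just (sym (classify-input⁻¹ x kind)) , refl

  -- Completeness: an accepting N-run from q is replayed by D from `at q`,
  -- with the certificate `choices r` on tape 0.
  choices : ∀ {q ns qf} → Run StepN q ns qf → List B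
  choices done                          = []
  choices (step {a = nothing} {q'} _ r) = εTo q' ∷ choices r
  choices (step {a = just _} {q'} _ r)  = moveTo q' ∷ choices r

  replay : ∀ {q ns qf} → Run StepN q ns qf → List (State × Letter B)
  replay (done {q})                    = (at q , nothing) ∷ []
  replay (step {q} {nothing} {q'} _ r) = (at q , just (εTo q')) ∷ replay r
  replay (step {q} {just l} {q'} _ r)  =
    (at q , just (moveTo q')) ∷ (reading q q' , Maybe.map symbol l) ∷ replay r

  replay-run : ∀ {q ns qf} (r : Run StepN q ns qf) → isFinal qf ≡ true → Run StepS (at q) (replay r) accepted
  replay-run done fin = step (cong (λ b → when b accepted) fin) done
  replay-run (step {q} {nothing} {q'} t r) fin =
    step (trans (cong (afterChoice q) (classify-εTo q')) (cong (λ b → when b (at q')) t)) (replay-run r fin)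
  replay-run (step {q} {just l} {q'} t r) fin =
    step (cong (afterChoice q) (classify-moveTo q')) (step (reading-step l t) (replay-run r fin))

  replay-tape₀ : ∀ {q ns qf} (r : Run StepN q ns qf) → tapeLabels tapeS zero (replay r) ≡ withEnd (choices r)
  replay-tape₀ done                          = refl
  replay-tape₀ (step {a = nothing} {q'} _ r) = cong (just (εTo q') ∷_) (replay-tape₀ r)
  replay-tape₀ (step {a = just _} {q'} _ r)  = cong (just (moveTo q') ∷_) (replay-tape₀ r)

  replay-inputs : ∀ {q ns qf} (r : Run StepN q ns qf) → SameInputs (replay r) ns
  replay-inputs done                     = sameInputs λ _ → refl
  replay-inputs (step {a = nothing} _ r) = sameInputs-ε (replay-inputs r)
  replay-inputs (step {a = just _} _ r)  = sameInputs-read (replay-inputs r)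

  DecodesFrom : Fin nQ → List (State × Letter B) → Set
  DecodesFrom q ds = Σ (Fin nQ) λ qf → Σ (List (Fin nQ × Maybe (Letter (Fin k)))) λ ns →
    Run StepN q ns qf × isFinal qf ≡ true × SameInputs ds ns

  extract : ∀ {q ds s} → Run StepS (at q) ds s → isAccepted s ≡ true → DecodesFrom q ds
  extract {q} (step {a = nothing} e r) acc with when-just (isFinal q) e | r
  ... | fin , refl | done       = q , [] , done , fin , sameInputs λ _ → refl
  ... | fin , refl | step () _
  extract {q} (step {a = just x} e r) acc with classify x | e
  ... | input _ | ()
  ... | choose-ε q' | e' with when-just (δN q nothing q') e'
  ...   | t , refl with extract r acc
  ...     | qf , ns , run , fin , same = qf , (q , nothing) ∷ ns , step t run , fin , sameInputs-ε same
  extract {q} (step {a = just x} e r) acc | choose-move q' | refl with r | acc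
  ... | done | ()
  ... | step {a = c} e₂ r₂ | acc₂ with reading-inv c e₂
  ...   | l , t , refl , refl with extract r₂ acc₂
  ...     | qf , ns , run , fin , same = qf , (q , just l) ∷ ns , step t run , fin , sameInputs-read same

  extract-initial : ∀ {ds s} → Run StepS initial ds s → isAccepted s ≡ true →
    Σ (Fin nQ) λ q₀ → isInitial q₀ ≡ true × DecodesFrom q₀ ds
  extract-initial (step {a = just x} e r) acc with classify x | e
  ... | choose-ε q₀ | e' with when-just (isInitial q₀) e'
  ...   | init , refl with extract r acc
  ...     | qf , ns , run , fin , same = q₀ , init , qf , ns , run , fin , sameInputs-initial same

  complete : (xs : Vec (List B) n) → InLangOver extra N xs → Σ (List B) λ x₀ → DAccepts D (x₀ ∷ xs)
  complete xs (ys , ys↦xs , q₀ , qf , ns , init , r , fin , tapesN) =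
    εTo q₀ ∷ choices r , code accepted , List.map (map₁ code) ds , encode-run run , refl ,
    λ i → trans (tapeLabels-map tapeS (tapeS ∘ decode) code (cong tapeS ∘ decode-code) i ds) (tapesS i)
    where
    ds : List (State × Letter B)
    ds = (initial , just (εTo q₀)) ∷ replay r

    run : Run StepS initial ds accepted
    run = step (trans (cong afterStart (classify-εTo q₀)) (cong (λ b → when b (at q₀)) init))
               (replay-run r fin)

    tapesS : (i : Fin (suc n)) → tapeLabels tapeS i ds ≡ withEnd (lookup ((εTo q₀ ∷ choices r) ∷ xs) i)
    tapesS zero    = cong (just (εTo q₀) ∷_) (replay-tape₀ r)
    tapesS (suc i) = begin
      tapeLabels tapeS (suc i) (replay r)                          ≡⟨ SameInputs.onTape (replay-inputs r) i ⟩
      List.map (Maybe.map symbol) (catMaybes (tapeLabels tapeN i ns)) ≡⟨ cong (List.map (Maybe.map symbol)) (tapesN i) ⟩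
      List.map (Maybe.map symbol) (withEnd (lookup ys i))          ≡⟨ withEnd-map symbol (lookup ys i) ⟩
      withEnd (List.map symbol (lookup ys i))                      ≡⟨ cong withEnd (lookup-mapped symbol ys↦xs i) ⟩
      withEnd (lookup xs i)                                        ∎

  sound : (xs : Vec (List B) n) → (Σ (List B) λ x₀ → DAccepts D (x₀ ∷ xs)) → InLangOver extra N xs
  sound xs (_ , _ , ds , run , acc , tapesD)
    with extract-initial (decode-run run) acc
  ... | q₀ , init , qf , ns , r , fin , sameInputs same = ys , ys↦xs , q₀ , qf , ns , init , r , fin , tapesN
    where
    readBack : (i : Fin n) → List.map (Maybe.map symbol) (catMaybes (tapeLabels tapeN i ns)) ≡ withEnd (lookup xs i)
    readBack i = begin
      List.map (Maybe.map symbol) (catMaybes (tapeLabels tapeN i ns)) ≡⟨ sym (same i) ⟩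
      tapeLabels tapeS (suc i) (List.map (map₁ decode) ds)            ≡⟨ tapeLabels-map (tapeS ∘ decode) tapeS decode (λ _ → refl) (suc i) ds ⟩
      tapeLabels (tapeS ∘ decode) (suc i) ds                          ≡⟨ tapesD (suc i) ⟩
      withEnd (lookup xs i)                                           ∎

    word : (i : Fin n) → Σ (List (Fin k)) λ v →
      List.map symbol v ≡ lookup xs i × catMaybes (tapeLabels tapeN i ns) ≡ withEnd v
    word i = withEnd-map⁻¹ symbol _ (lookup xs i) (readBack i)

    ys : Vec (List (Fin k)) n
    ys = tabulate (proj₁ ∘ word)

    ys↦xs : Vec.map (List.map symbol) ys ≡ xs
    ys↦xs = tabulate-mapped symbol (proj₁ ∘ word) (proj₁ ∘ proj₂ ∘ word)

    tapesN : (i : Fin n) → catMaybes (tapeLabels tapeN i ns) ≡ withEnd (lookup ys i)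
    tapesN i = trans (proj₂ (proj₂ (word i))) (cong withEnd (sym (lookup∘tabulate (proj₁ ∘ word) i)))

-- The theorem: D over B = A ⊔ {ε-to q, move-to q} witnesses quasi-regularity of a
-- predicate projecting onto L(N).  The construction works for every n.
mainTheorem5 : (k n : ℕ) → 1 ≤ n → (N : NAut (Fin k) n) →
    Σ ℕ λ extra → Σ (DAut (Fin (k + extra)) (suc n)) λ D →
    (xs : Vec (List (Fin (k + extra))) n) →
    InLangOver extra N xs ⇔ Σ (List (Fin (k + extra))) λ x0 → DAccepts D (x0 ∷ xs)
mainTheorem5 k n _ N = extra , D , λ xs → mk⇔ (complete xs) (sound xs)
  where open Simulation k n N
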